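{- Let $0\le\ell\le k$ be integers, $u,n$ positive integers, and $0<\varepsilon\le1$ with $(1-\varepsilon)^{\ell}n\le u$. Suppose $G$ is a graph on $n$ vertices in which every vertex subset $S$ with $|S|\ge u$ is such that $G[S]$ has maximum degree at least $\varepsilon|S|-1$. Then the number of independent sets of order $k$ in $G$ is at most $\binom{n}{\ell}\binom{u}{k-\ell}$.
   Formalization: The parameter ε is taken in the rationals. -}

module Defs where

open import Data.Nat using (ℕ; zero; suc)
open import Data.Bool using (Bool; true; false)
open import Data.Fin using (Fin)
open import Data.Vec using (Vec; []; _∷_; tabulate)
open import Data.List using (List; []; _∷_; map; _++_; filter; length)
open import Data.Fin.Subset using (Subset; _∈_; _∩_; ∣_∣; inside; outside)
open import Data.Fin.Subset.Properties using (_∈?_)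
open import Data.Fin.Properties using (all?)
open import Data.Rational using (ℚ; 1ℚ; _*_)
open import Relation.Binary.PropositionalEquality using (_≡_)
open import Relation.Nullary using (Dec; ¬_)
open import Relation.Nullary.Decidable using (_→-dec_; ¬?)
open import Data.Bool.Properties using () renaming (_≟_ to _≟ᵇ_)

record Graph (n : ℕ) : Set where
  field
    Adj   : Fin n → Fin n → Bool
    sym   : ∀ v w → Adj v w ≡ Adj w v
    irrefl : ∀ v → Adj v v ≡ false
open Graph public

N : ∀ {n} → Graph n → Fin n → Subset n
N G v = tabulate (Adj G v)

degIn : ∀ {n} → Graph n → Subset n → Fin n → ℕ
degIn G S v = ∣ S ∩ N G v ∣

Independent : ∀ {n} → Graph n → Subset n → Set
Independent G S = ∀ v w → v ∈ S → w ∈ S → Adj G v w ≡ false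

independent? : ∀ {n} (G : Graph n) (S : Subset n) → Dec (Independent G S)
independent? G S =
  all? λ v → all? λ w → (v ∈? S) →-dec ((w ∈? S) →-dec (Adj G v w ≟ᵇ false))

allSubsets : (n : ℕ) → List (Subset n)
allSubsets zero = [] ∷ []
allSubsets (suc n) = map (outside ∷_) (allSubsets n) ++ map (inside ∷_) (allSubsets n)

numIndep : ∀ {n} → Graph n → ℕ → ℕ
numIndep {n} G k =
  length (filter (λ S → independent? G S) (filter (λ S → ∣ S ∣ Data.Nat.≟ k) (allSubsets n)))

_^ℚ_ : ℚ → ℕ → ℚ
x ^ℚ zero = 1ℚ
x ^ℚ suc m = x * (x ^ℚ m)

{-# OPTIONS --safe #-}
-- Write i_j(S) for the number of independent j-subsets of G[S]. Splitting by whether a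
-- vertex v is used gives i_{j+1}(S) ≤ i_j(S ∖ N[v]) + i_{j+1}(S ∖ {v}). Call S r-shrinking if
-- u ≤ |S| implies (1-ε)^r |S| ≤ u. While |S| ≥ u, the vertex v supplied by the hypothesis
-- has degree ≥ ε|S| - 1, so |S ∖ N[v]| ≤ (1-ε)|S| and S ∖ N[v] is (r-1)-shrinking. Induction
-- on |S| with Pascal's rule then gives i_{r+m}(S) ≤ C(|S|, r) C(u, m); the whole vertex set is
-- ℓ-shrinking by assumption, and r = ℓ, m = k - ℓ yields the claim.
module Submission where

open import Defs hiding (sym)
open import Data.Nat using (ℕ; _≤_; _∸_; _*_)
open import Data.Nat.Combinatorics using (_C_)
open import Data.Fin.Subset using (Subset; _∈_; ∣_∣)
open import Data.Product using (∃; _×_)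
open import Data.Rational using (ℚ; 0ℚ; 1ℚ; _<_; _-_; _/_) renaming (_≤_ to _≤ℚ_; _*_ to _*ℚ_)
open import Data.Integer using (+_)

open import Level using (Level; 0ℓ)
open import Function using (_∘_)
open import Data.Bool using (true; not)
open import Data.Nat using (zero; suc; _+_; z≤n; _≤?_; _≤′_; ≤′-refl; ≤′-step)
  renaming (_≟_ to _≟ℕ_; _<_ to _<ℕ_)
open import Data.Nat.Properties
  using (≤-refl; ≤-reflexive; ≤-trans; ≤-<-trans; <⇒≤; ≰⇒>; ≤⇒≤′; m≤n+m; suc-injective;
         +-suc; +-comm; +-identityʳ; *-identityˡ; +-monoˡ-≤; +-monoʳ-≤; +-mono-≤; *-monoˡ-≤;
         *-distribʳ-+; m+[n∸m]≡n; module ≤-Reasoning)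
open import Data.Nat.Combinatorics using (nCk+nC[k+1]≡[n+1]C[k+1])
open import Data.Nat.Induction using (<-wellFounded)
import Data.Nat.Coprimality as Coprime
import Data.Integer as ℤ
import Data.Integer.Properties as ℤ
open import Data.Rational using (mkℚ; *≤*; -_; nonNegative) renaming (_+_ to _+ℚ_)
import Data.Rational.Properties as ℚ
open import Data.Rational.Solver using (module +-*-Solver)
open import Data.Product using (_,_)
open import Data.Fin as Fin using (Fin)
open import Data.Fin.Subset using (_∉_; _⊆_; _∩_; _─_; ⁅_⁆; ⊤; inside; outside; Nonempty; Empty)
open import Data.Fin.Subset.Properties
  using (_∈?_; _⊆?_; ⊆⊤; nonempty?; Empty-unique; ∣⊥∣≡0; ∣⊤∣≡n; drop-not-there; p⊆q⇒∣p∣≤∣q∣;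
         ∣p─q∣≤∣p∣; p─q─r≡p─r─q; x∈p∧x∉q⇒x∈p─q; x∈p∧x≢y⇒x∈p-y; x∈p⇒∣p-x∣<∣p∣)
open import Data.Vec using ([]; _∷_; updateAt; here)
open import Data.Vec.Properties
  using ([]=-injective; []=⇒lookup; lookup∘tabulate; updateAt-updates; updateAt-minimal)
open import Data.List using (List; []; _∷_; map; _++_; filter; length)
open import Data.List.Properties using (filter-++; length-++; filter-none)
open import Data.List.Relation.Unary.All using (universal)
open import Data.List.Relation.Binary.Sublist.Propositional using (⊆-refl)
open import Data.List.Relation.Binary.Sublist.Propositional.Properties using (filter⁺; length-mono-≤)
open import Induction.WellFounded using (module All)
import Relation.Binary.Construct.On as On
open import Relation.Binary.PropositionalEquality
  using (_≡_; refl; sym; trans; cong; cong₂; subst; subst₂; module ≡-Reasoning)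
open import Relation.Nullary using (¬_; Dec; yes; no; contradiction; _×-dec_)
open import Relation.Unary using (Pred; Decidable)
open import Relation.Unary.Properties using (_∩?_; ∁?)

private
  variable
    a b p q : Level
    A : Set a
    B : Set b
    n : ℕ

module _ {P : Pred A p} (P? : Decidable P) where

  length-filter-map : (f : B → A) (xs : List B) →
                      length (filter P? (map f xs)) ≡ length (filter (P? ∘ f) xs)
  length-filter-map f [] = refl
  length-filter-map f (x ∷ xs) with P? (f x)
  ... | yes _ = cong suc (length-filter-map f xs)
  ... | no _  = length-filter-map f xs

  module _ {Q : Pred A q} (Q? : Decidable Q) where

    length-filter-filter : (xs : List A) →
                           length (filter Q? (filter P? xs)) ≡ length (filter (P? ∩? Q?) xs)
    length-filter-filter [] = refl
    length-filter-filter (x ∷ xs) with P? x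
    ... | no _ = length-filter-filter xs
    ... | yes _ with Q? x
    ...   | yes _ = cong suc (length-filter-filter xs)
    ...   | no _  = length-filter-filter xs

    length-filter-partition : (xs : List A) →
      length (filter P? xs) ≡ length (filter (P? ∩? Q?) xs) + length (filter (P? ∩? ∁? Q?) xs)
    length-filter-partition [] = refl
    length-filter-partition (x ∷ xs) with P? x
    ... | no _ = length-filter-partition xs
    ... | yes _ with Q? x
    ...   | yes _ = cong suc (length-filter-partition xs)
    ...   | no _  = trans (cong suc (length-filter-partition xs)) (sym (+-suc _ _))

count : {P : Pred (Subset n) p} → Decidable P → ℕ
count {n} P? = length (filter P? (allSubsets n))

count-suc : {P : Pred (Subset (suc n)) p} (P? : Decidable P) →
            count P? ≡ count (P? ∘ (outside ∷_)) + count (P? ∘ (inside ∷_))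
count-suc {n} P? = begin
  length (filter P? (map (outside ∷_) Xs ++ map (inside ∷_) Xs))
    ≡⟨ cong length (filter-++ P? (map (outside ∷_) Xs) (map (inside ∷_) Xs)) ⟩
  length (filter P? (map (outside ∷_) Xs) ++ filter P? (map (inside ∷_) Xs))
    ≡⟨ length-++ (filter P? (map (outside ∷_) Xs)) ⟩
  length (filter P? (map (outside ∷_) Xs)) + length (filter P? (map (inside ∷_) Xs))
    ≡⟨ cong₂ _+_ (length-filter-map P? (outside ∷_) Xs) (length-filter-map P? (inside ∷_) Xs) ⟩
  count (P? ∘ (outside ∷_)) + count (P? ∘ (inside ∷_)) ∎
  where
  open ≡-Reasoning
  Xs : List (Subset n)
  Xs = allSubsets n

count-mono : {P : Pred (Subset n) p} {Q : Pred (Subset n) q} (P? : Decidable P) (Q? : Decidable Q) →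
             (∀ {X} → P X → Q X) → count P? ≤ count Q?
count-mono {n} P? Q? P⇒Q = length-mono-≤ (filter⁺ P? Q? {as = allSubsets n} (λ { refl → P⇒Q }) ⊆-refl)

count-none : {P : Pred (Subset n) p} (P? : Decidable P) → (∀ X → ¬ P X) → count P? ≡ 0
count-none {n} P? ¬P = cong length (filter-none P? (universal ¬P (allSubsets n)))

count-∣∣≡0≤1 : count {n = n} (λ X → ∣ X ∣ ≟ℕ 0) ≤ 1
count-∣∣≡0≤1 {zero} = ≤-refl
count-∣∣≡0≤1 {suc n} = begin
  count {n = suc n} (λ X → ∣ X ∣ ≟ℕ 0)
    ≡⟨ count-suc {n = n} (λ X → ∣ X ∣ ≟ℕ 0) ⟩
  count {n = n} (λ X → ∣ X ∣ ≟ℕ 0) + count {n = n} (λ X → suc ∣ X ∣ ≟ℕ 0)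
    ≡⟨ cong₂ _+_ refl (count-none {n = n} (λ X → suc ∣ X ∣ ≟ℕ 0) (λ _ ())) ⟩
  count {n = n} (λ X → ∣ X ∣ ≟ℕ 0) + 0
    ≡⟨ +-identityʳ _ ⟩
  count {n = n} (λ X → ∣ X ∣ ≟ℕ 0)
    ≤⟨ count-∣∣≡0≤1 {n} ⟩
  1 ∎
  where open ≤-Reasoning

toggle : Fin n → Subset n → Subset n
toggle v X = updateAt X v not

count-toggle : {P : Pred (Subset n) p} (v : Fin n) (P? : Decidable P) → count P? ≡ count (P? ∘ toggle v)
count-toggle Fin.zero P? =
  trans (count-suc P?)
        (trans (+-comm (count (P? ∘ (outside ∷_))) _) (sym (count-suc (P? ∘ toggle Fin.zero))))
count-toggle (Fin.suc v) P? =
  trans (count-suc P?)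
        (trans (cong₂ _+_ (count-toggle v (P? ∘ (outside ∷_))) (count-toggle v (P? ∘ (inside ∷_))))
               (sym (count-suc (P? ∘ toggle (Fin.suc v)))))

∈-toggle⇒∉ : {v : Fin n} {X : Subset n} → v ∈ toggle v X → v ∉ X
∈-toggle⇒∉ {v = v} {X} v∈ v∈X with () ← []=-injective v∈ (updateAt-updates v X v∈X)

⊆-toggle : {v : Fin n} {X : Subset n} → v ∉ X → X ⊆ toggle v X
⊆-toggle {v = v} {X} v∉X {i} i∈X = updateAt-minimal i v X (λ { refl → v∉X i∈X }) i∈X

∣toggle∣ : {v : Fin n} {X : Subset n} → v ∉ X → ∣ toggle v X ∣ ≡ suc ∣ X ∣
∣toggle∣ {v = Fin.zero}  {outside ∷ X} v∉X = refl
∣toggle∣ {v = Fin.zero}  {inside ∷ X}  v∉X = contradiction here v∉X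
∣toggle∣ {v = Fin.suc v} {outside ∷ X} v∉X = ∣toggle∣ (drop-not-there v∉X)
∣toggle∣ {v = Fin.suc v} {inside ∷ X}  v∉X = cong suc (∣toggle∣ (drop-not-there v∉X))

∣p∩q∣+∣p─q∣≡∣p∣ : (p q : Subset n) → ∣ p ∩ q ∣ + ∣ p ─ q ∣ ≡ ∣ p ∣
∣p∩q∣+∣p─q∣≡∣p∣ []            []            = refl
∣p∩q∣+∣p─q∣≡∣p∣ (outside ∷ p) (outside ∷ q) = ∣p∩q∣+∣p─q∣≡∣p∣ p q
∣p∩q∣+∣p─q∣≡∣p∣ (outside ∷ p) (inside ∷ q)  = ∣p∩q∣+∣p─q∣≡∣p∣ p q
∣p∩q∣+∣p─q∣≡∣p∣ (inside ∷ p)  (outside ∷ q) = trans (+-suc _ _) (cong suc (∣p∩q∣+∣p─q∣≡∣p∣ p q))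
∣p∩q∣+∣p─q∣≡∣p∣ (inside ∷ p)  (inside ∷ q)  = cong suc (∣p∩q∣+∣p─q∣≡∣p∣ p q)

∣∣-rec : (P : Subset n → Set p) → (∀ S → (∀ X → ∣ X ∣ <ℕ ∣ S ∣ → P X) → P S) → ∀ S → P S
∣∣-rec P step = All.wfRec (On.wellFounded ∣_∣ <-wellFounded) _ P (λ S rec → step S (λ X → rec {X}))

nCk≤[1+n]Ck : ∀ n k → n C k ≤ suc n C k
nCk≤[1+n]Ck n zero    = ≤-refl
nCk≤[1+n]Ck n (suc k) = subst (n C suc k ≤_) (nCk+nC[k+1]≡[n+1]C[k+1] n k) (m≤n+m _ _)

C-monoˡ-≤ : ∀ {m o} k → m ≤ o → m C k ≤ o C k
C-monoˡ-≤ k m≤o = go (≤⇒≤′ m≤o)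
  where
  go : ∀ {m o} → m ≤′ o → m C k ≤ o C k
  go ≤′-refl          = ≤-refl
  go (≤′-step m≤′o) = ≤-trans (go m≤′o) (nCk≤[1+n]Ck _ k)

C-pascal-≤ : ∀ {a b c} k → a ≤ b → b <ℕ c → a C k + b C suc k ≤ c C suc k
C-pascal-≤ {a} {b} {c} k a≤b b<c = begin
  a C k + b C suc k   ≤⟨ +-monoˡ-≤ (b C suc k) (C-monoˡ-≤ k a≤b) ⟩
  b C k + b C suc k   ≡⟨ nCk+nC[k+1]≡[n+1]C[k+1] b k ⟩
  suc b C suc k       ≤⟨ C-monoˡ-≤ (suc k) b<c ⟩
  c C suc k           ∎
  where open ≤-Reasoning

fromℕ : ℕ → ℚ
fromℕ m = + m / 1

fromℕ≡mkℚ : ∀ m → fromℕ m ≡ mkℚ (+ m) 0 (Coprime.sym (Coprime.1-coprimeTo m))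
fromℕ≡mkℚ m = ℚ.normalize-coprime (Coprime.sym (Coprime.1-coprimeTo m))

fromℕ-+ : ∀ m o → fromℕ (m + o) ≡ fromℕ m +ℚ fromℕ o
fromℕ-+ m o rewrite fromℕ≡mkℚ m | fromℕ≡mkℚ o =
  sym (ℚ./-cong {+ m ℤ.* + 1 ℤ.+ + o ℤ.* + 1} {1}
                (cong₂ ℤ._+_ (ℤ.*-identityʳ (+ m)) (ℤ.*-identityʳ (+ o))) refl)

fromℕ-mono-≤ : ∀ {m o} → m ≤ o → fromℕ m ≤ℚ fromℕ o
fromℕ-mono-≤ {m} {o} m≤o rewrite fromℕ≡mkℚ m | fromℕ≡mkℚ o =
  *≤* (subst₂ ℤ._≤_ (sym (ℤ.*-identityʳ (+ m))) (sym (ℤ.*-identityʳ (+ o))) (ℤ.+≤+ m≤o))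

fromℕ-cancel-≤ : ∀ {m o} → fromℕ m ≤ℚ fromℕ o → m ≤ o
fromℕ-cancel-≤ {m} {o} le rewrite fromℕ≡mkℚ m | fromℕ≡mkℚ o =
  ℤ.drop‿+≤+ (subst₂ ℤ._≤_ (ℤ.*-identityʳ (+ m)) (ℤ.*-identityʳ (+ o)) (ℚ.drop-*≤* le))

^ℚ-nonNeg : ∀ {x} r → 0ℚ ≤ℚ x → 0ℚ ≤ℚ x ^ℚ r
^ℚ-nonNeg zero    _   = ℚ.nonNegative⁻¹ 1ℚ
^ℚ-nonNeg {x} (suc r) 0≤x =
  subst (_≤ℚ x *ℚ x ^ℚ r) (ℚ.*-zeroʳ x) (ℚ.*-monoˡ-≤-nonNeg x {{nonNegative 0≤x}} (^ℚ-nonNeg r 0≤x))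

t≤[1-ε]s : ∀ ε {s d t} → ε *ℚ fromℕ s - 1ℚ ≤ℚ fromℕ d → d + suc t ≤ s →
               fromℕ t ≤ℚ (1ℚ - ε) *ℚ fromℕ s
t≤[1-ε]s ε {s} {d} {t} deg d+1+t≤s = begin
  fromℕ t
    ≡⟨ solve 2 (λ t d → t := (d :+ (con 1ℚ :+ t)) :- (d :+ con 1ℚ)) refl (fromℕ t) (fromℕ d) ⟩
  (fromℕ d +ℚ (1ℚ +ℚ fromℕ t)) - (fromℕ d +ℚ 1ℚ)
    ≡⟨ cong (_- (fromℕ d +ℚ 1ℚ)) (sym (trans (fromℕ-+ d (suc t)) (cong (fromℕ d +ℚ_) (fromℕ-+ 1 t)))) ⟩
  fromℕ (d + suc t) - (fromℕ d +ℚ 1ℚ)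
    ≤⟨ ℚ.+-monoˡ-≤ (- (fromℕ d +ℚ 1ℚ)) (fromℕ-mono-≤ d+1+t≤s) ⟩
  fromℕ s - (fromℕ d +ℚ 1ℚ)
    ≤⟨ ℚ.+-monoʳ-≤ (fromℕ s) (ℚ.neg-antimono-≤ εs≤d+1) ⟩
  fromℕ s - ε *ℚ fromℕ s
    ≡⟨ solve 2 (λ s e → s :- e :* s := (con 1ℚ :- e) :* s) refl (fromℕ s) ε ⟩
  (1ℚ - ε) *ℚ fromℕ s ∎
  where
  open ℚ.≤-Reasoning
  open +-*-Solver
  εs≤d+1 : ε *ℚ fromℕ s ≤ℚ fromℕ d +ℚ 1ℚ
  εs≤d+1 = subst (_≤ℚ fromℕ d +ℚ 1ℚ)
                 (solve 2 (λ e s → (e :* s :- con 1ℚ) :+ con 1ℚ := e :* s) refl ε (fromℕ s))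
                 (ℚ.+-monoˡ-≤ 1ℚ deg)

module _ (G : Graph n) where

  ∈N⇒Adj : ∀ {v w} → w ∈ N G v → Adj G v w ≡ true
  ∈N⇒Adj {v} {w} w∈N = trans (sym (lookup∘tabulate (Adj G v) w)) ([]=⇒lookup w∈N)

  ∉N-self : ∀ v → v ∉ N G v
  ∉N-self v v∈N with () ← trans (sym (irrefl G v)) (∈N⇒Adj v∈N)

  Independent⇒∉N : ∀ {I v w} → Independent G I → v ∈ I → w ∈ I → w ∉ N G v
  Independent⇒∉N indI v∈I w∈I w∈N with () ← trans (sym (indI _ _ v∈I w∈I)) (∈N⇒Adj w∈N)

  Independent-⊆ : ∀ {I J} → I ⊆ J → Independent G J → Independent G I
  Independent-⊆ I⊆J indJ v w v∈I w∈I = indJ v w (I⊆J v∈I) (I⊆J w∈I)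

  _∖N[_] : Subset n → Fin n → Subset n
  S ∖N[ v ] = S ─ N G v ─ ⁅ v ⁆

  ∣∖N∣≤∣─∣ : ∀ S v → ∣ S ∖N[ v ] ∣ ≤ ∣ S ─ ⁅ v ⁆ ∣
  ∣∖N∣≤∣─∣ S v = subst (λ X → ∣ X ∣ ≤ ∣ S ─ ⁅ v ⁆ ∣) (sym (p─q─r≡p─r─q S (N G v) ⁅ v ⁆))
                       (∣p─q∣≤∣p∣ (S ─ ⁅ v ⁆) (N G v))

  ∣∖N∣<∣S∣ : ∀ {S v} → v ∈ S → ∣ S ∖N[ v ] ∣ <ℕ ∣ S ∣
  ∣∖N∣<∣S∣ {S} {v} v∈S = ≤-<-trans (∣∖N∣≤∣─∣ S v) (x∈p⇒∣p-x∣<∣p∣ v∈S)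

  degIn+∣∖N∣<∣S∣ : ∀ {S v} → v ∈ S → degIn G S v + suc ∣ S ∖N[ v ] ∣ ≤ ∣ S ∣
  degIn+∣∖N∣<∣S∣ {S} {v} v∈S =
    subst (degIn G S v + suc ∣ S ∖N[ v ] ∣ ≤_) (∣p∩q∣+∣p─q∣≡∣p∣ S (N G v))
          (+-monoʳ-≤ (degIn G S v) (x∈p⇒∣p-x∣<∣p∣ (x∈p∧x∉q⇒x∈p─q v∈S (∉N-self v))))

  IndependentIn : Subset n → ℕ → Pred (Subset n) 0ℓ
  IndependentIn S j I = I ⊆ S × Independent G I × ∣ I ∣ ≡ j

  independentIn? : ∀ S j → Decidable (IndependentIn S j)
  independentIn? S j I = I ⊆? S ×-dec independent? G I ×-dec ∣ I ∣ ≟ℕ j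

  numIndepIn : Subset n → ℕ → ℕ
  numIndepIn S j = count (independentIn? S j)

  numIndep≤numIndepIn⊤ : ∀ k → numIndep G k ≤ numIndepIn ⊤ k
  numIndep≤numIndepIn⊤ k = begin
    numIndep G k
      ≡⟨ length-filter-filter (λ I → ∣ I ∣ ≟ℕ k) (independent? G) (allSubsets n) ⟩
    count ((λ I → ∣ I ∣ ≟ℕ k) ∩? independent? G)
      ≤⟨ count-mono _ (independentIn? ⊤ k) (λ (∣I∣≡k , indI) → ⊆⊤ , indI , ∣I∣≡k) ⟩
    numIndepIn ⊤ k ∎
    where open ≤-Reasoning

  numIndepIn-empty : ∀ {S} j → Empty S → numIndepIn S (suc j) ≡ 0
  numIndepIn-empty {S} j S-empty = count-none (independentIn? S (suc j)) absurd
    where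
    ∣S∣≡0 : ∣ S ∣ ≡ 0
    ∣S∣≡0 = trans (cong ∣_∣ (Empty-unique S-empty)) (∣⊥∣≡0 n)
    absurd : ∀ I → ¬ IndependentIn S (suc j) I
    absurd I (I⊆S , _ , ∣I∣≡1+j) with () ← subst₂ _≤_ ∣I∣≡1+j ∣S∣≡0 (p⊆q⇒∣p∣≤∣q∣ I⊆S)

  toggle-pivot : ∀ {S v j J} → IndependentIn S (suc j) (toggle v J) × v ∈ toggle v J →
                 IndependentIn (S ∖N[ v ]) j J
  toggle-pivot {S} {v} {j} {J} ((T⊆S , indT , ∣T∣≡1+j) , v∈T) =
    J⊆S∖N[v] , Independent-⊆ J⊆T indT , suc-injective (trans (sym (∣toggle∣ v∉J)) ∣T∣≡1+j)
    where
    v∉J : v ∉ J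
    v∉J = ∈-toggle⇒∉ v∈T
    J⊆T : J ⊆ toggle v J
    J⊆T = ⊆-toggle v∉J
    J⊆S∖N[v] : J ⊆ S ∖N[ v ]
    J⊆S∖N[v] i∈J = x∈p∧x≢y⇒x∈p-y
      (x∈p∧x∉q⇒x∈p─q (T⊆S (J⊆T i∈J)) (Independent⇒∉N indT v∈T (J⊆T i∈J)))
      (λ { refl → v∉J i∈J })

  numIndepIn-delete : ∀ S v j →
    numIndepIn S (suc j) ≤ numIndepIn (S ∖N[ v ]) j + numIndepIn (S ─ ⁅ v ⁆) (suc j)
  numIndepIn-delete S v j = begin
    count P?
      ≡⟨ length-filter-partition P? (v ∈?_) (allSubsets n) ⟩
    count (P? ∩? (v ∈?_)) + count (P? ∩? ∁? (v ∈?_))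
      ≡⟨ cong₂ _+_ (count-toggle v (P? ∩? (v ∈?_))) refl ⟩
    count ((P? ∩? (v ∈?_)) ∘ toggle v) + count (P? ∩? ∁? (v ∈?_))
      ≤⟨ +-mono-≤ (count-mono _ (independentIn? (S ∖N[ v ]) j) toggle-pivot)
                  (count-mono _ (independentIn? (S ─ ⁅ v ⁆) (suc j)) avoid-pivot) ⟩
    numIndepIn (S ∖N[ v ]) j + numIndepIn (S ─ ⁅ v ⁆) (suc j) ∎
    where
    open ≤-Reasoning
    P? : Decidable (IndependentIn S (suc j))
    P? = independentIn? S (suc j)
    avoid-pivot : ∀ {I} → IndependentIn S (suc j) I × v ∉ I → IndependentIn (S ─ ⁅ v ⁆) (suc j) I
    avoid-pivot ((I⊆S , indI , ∣I∣≡1+j) , v∉I) =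
      (λ i∈I → x∈p∧x≢y⇒x∈p-y (I⊆S i∈I) (λ { refl → v∉I i∈I })) , indI , ∣I∣≡1+j

  numIndepIn≤C : ∀ S j → numIndepIn S j ≤ ∣ S ∣ C j
  numIndepIn≤C = ∣∣-rec Bound step
    where
    Bound : Subset n → Set
    Bound S = ∀ j → numIndepIn S j ≤ ∣ S ∣ C j
    step : ∀ S → (∀ X → ∣ X ∣ <ℕ ∣ S ∣ → Bound X) → Bound S
    step S ih zero =
      ≤-trans (count-mono (independentIn? S 0) (λ I → ∣ I ∣ ≟ℕ 0) (λ (_ , _ , ∣I∣≡0) → ∣I∣≡0))
              (count-∣∣≡0≤1 {n})
    step S ih (suc j) with nonempty? S
    ... | no S-empty = ≤-trans (≤-reflexive (numIndepIn-empty j S-empty)) z≤n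
    ... | yes (v , v∈S) = begin
      numIndepIn S (suc j)
        ≤⟨ numIndepIn-delete S v j ⟩
      numIndepIn (S ∖N[ v ]) j + numIndepIn (S ─ ⁅ v ⁆) (suc j)
        ≤⟨ +-mono-≤ (ih (S ∖N[ v ]) (∣∖N∣<∣S∣ v∈S) j)
                    (ih (S ─ ⁅ v ⁆) (x∈p⇒∣p-x∣<∣p∣ v∈S) (suc j)) ⟩
      ∣ S ∖N[ v ] ∣ C j + ∣ S ─ ⁅ v ⁆ ∣ C suc j
        ≤⟨ C-pascal-≤ j (∣∖N∣≤∣─∣ S v) (x∈p⇒∣p-x∣<∣p∣ v∈S) ⟩
      ∣ S ∣ C suc j ∎
      where open ≤-Reasoning

  module _ (u : ℕ) (ε : ℚ) (ε≤1 : ε ≤ℚ 1ℚ)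
    (dense : (S : Subset n) → u ≤ ∣ S ∣ →
             ∃ λ v → v ∈ S × ε *ℚ fromℕ ∣ S ∣ - 1ℚ ≤ℚ fromℕ (degIn G S v)) where

    Shrinks : ℕ → Subset n → Set
    Shrinks r S = u ≤ ∣ S ∣ → (1ℚ - ε) ^ℚ r *ℚ fromℕ ∣ S ∣ ≤ℚ fromℕ u

    0≤1-ε : 0ℚ ≤ℚ 1ℚ - ε
    0≤1-ε = subst (_≤ℚ 1ℚ - ε) (ℚ.+-inverseʳ ε) (ℚ.+-monoˡ-≤ (- ε) ε≤1)

    shrinks-anti : ∀ r S X → ∣ X ∣ ≤ ∣ S ∣ → Shrinks r S → Shrinks r X
    shrinks-anti r S X X≤S shrS u≤X =
      ℚ.≤-trans (ℚ.*-monoˡ-≤-nonNeg ((1ℚ - ε) ^ℚ r) {{nonNegative (^ℚ-nonNeg r 0≤1-ε)}}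
                                     (fromℕ-mono-≤ X≤S))
                (shrS (≤-trans u≤X X≤S))

    shrinks-zero : ∀ S → Shrinks 0 S → ∣ S ∣ ≤ u
    shrinks-zero S shrS with u ≤? ∣ S ∣
    ... | yes u≤S = fromℕ-cancel-≤ (subst (_≤ℚ fromℕ u) (ℚ.*-identityˡ (fromℕ ∣ S ∣)) (shrS u≤S))
    ... | no u≰S  = <⇒≤ (≰⇒> u≰S)

    shrinks-pivot : ∀ r S → Shrinks (suc r) S → Nonempty S → ∃ λ v → v ∈ S × Shrinks r (S ∖N[ v ])
    shrinks-pivot r S shrS (w , w∈S) = pivot (u ≤? ∣ S ∣)
      where
      pivot : Dec (u ≤ ∣ S ∣) → ∃ λ v → v ∈ S × Shrinks r (S ∖N[ v ])
      pivot (no u≰S) = w , w∈S , λ u≤ → contradiction (≤-trans u≤ (<⇒≤ (∣∖N∣<∣S∣ w∈S))) u≰S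
      pivot (yes u≤S) = let v , v∈S , deg = dense S u≤S in v , v∈S , λ _ → begin
        x ^ℚ r *ℚ fromℕ ∣ S ∖N[ v ] ∣
          ≤⟨ ℚ.*-monoˡ-≤-nonNeg (x ^ℚ r) {{nonNegative (^ℚ-nonNeg r 0≤1-ε)}}
               (t≤[1-ε]s ε deg (degIn+∣∖N∣<∣S∣ v∈S)) ⟩
        x ^ℚ r *ℚ (x *ℚ fromℕ ∣ S ∣)
          ≡⟨ trans (sym (ℚ.*-assoc (x ^ℚ r) x (fromℕ ∣ S ∣)))
                   (cong (_*ℚ fromℕ ∣ S ∣) (ℚ.*-comm (x ^ℚ r) x)) ⟩
        x ^ℚ suc r *ℚ fromℕ ∣ S ∣
          ≤⟨ shrS u≤S ⟩
        fromℕ u ∎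
        where
        open ℚ.≤-Reasoning
        x : ℚ
        x = 1ℚ - ε

    numIndepIn-bound : ∀ m S r → Shrinks r S → numIndepIn S (r + m) ≤ (∣ S ∣ C r) * (u C m)
    numIndepIn-bound m = ∣∣-rec Bound step
      where
      Bound : Subset n → Set
      Bound S = ∀ r → Shrinks r S → numIndepIn S (r + m) ≤ (∣ S ∣ C r) * (u C m)
      step : ∀ S → (∀ X → ∣ X ∣ <ℕ ∣ S ∣ → Bound X) → Bound S
      step S ih zero shrS = begin
        numIndepIn S m   ≤⟨ numIndepIn≤C S m ⟩
        ∣ S ∣ C m        ≤⟨ C-monoˡ-≤ m (shrinks-zero S shrS) ⟩
        u C m            ≡⟨ sym (*-identityˡ (u C m)) ⟩
        1 * (u C m)      ∎
        where open ≤-Reasoning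
      step S ih (suc r) shrS = split (nonempty? S)
        where
        goal : Set
        goal = numIndepIn S (suc r + m) ≤ (∣ S ∣ C suc r) * (u C m)
        delete : (∃ λ v → v ∈ S × Shrinks r (S ∖N[ v ])) → goal
        delete (v , v∈S , shr∖N) = begin
          numIndepIn S (suc r + m)
            ≤⟨ numIndepIn-delete S v (r + m) ⟩
          numIndepIn (S ∖N[ v ]) (r + m) + numIndepIn (S ─ ⁅ v ⁆) (suc r + m)
            ≤⟨ +-mono-≤ (ih (S ∖N[ v ]) (∣∖N∣<∣S∣ v∈S) r shr∖N)
                        (ih (S ─ ⁅ v ⁆) ∣S─v∣<∣S∣ (suc r)
                            (shrinks-anti (suc r) S (S ─ ⁅ v ⁆) (<⇒≤ ∣S─v∣<∣S∣) shrS)) ⟩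
          (∣ S ∖N[ v ] ∣ C r) * c + (∣ S ─ ⁅ v ⁆ ∣ C suc r) * c
            ≡⟨ sym (*-distribʳ-+ c (∣ S ∖N[ v ] ∣ C r) _) ⟩
          (∣ S ∖N[ v ] ∣ C r + ∣ S ─ ⁅ v ⁆ ∣ C suc r) * c
            ≤⟨ *-monoˡ-≤ c (C-pascal-≤ r (∣∖N∣≤∣─∣ S v) ∣S─v∣<∣S∣) ⟩
          (∣ S ∣ C suc r) * c ∎
          where
          open ≤-Reasoning
          c : ℕ
          c = u C m
          ∣S─v∣<∣S∣ : ∣ S ─ ⁅ v ⁆ ∣ <ℕ ∣ S ∣
          ∣S─v∣<∣S∣ = x∈p⇒∣p-x∣<∣p∣ v∈S
        split : Dec (Nonempty S) → goal
        split (no S-empty)     = ≤-trans (≤-reflexive (numIndepIn-empty (r + m) S-empty)) z≤n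
        split (yes S-nonempty) = delete (shrinks-pivot r S shrS S-nonempty)

lemma2p1 : (ℓ k u n : ℕ) → ℓ ≤ k → 1 ≤ u → 1 ≤ n
    → (ε : ℚ) → 0ℚ < ε → ε ≤ℚ 1ℚ
    → ((1ℚ - ε) ^ℚ ℓ) *ℚ (+ n / 1) ≤ℚ (+ u / 1)
    → (G : Graph n)
    → ((S : Subset n) → u ≤ ∣ S ∣
        → ∃ λ v → v ∈ S × ((ε *ℚ (+ ∣ S ∣ / 1)) - 1ℚ ≤ℚ (+ degIn G S v / 1)))
    → numIndep G k ≤ (n C ℓ) * (u C (k ∸ ℓ))
lemma2p1 ℓ k u n ℓ≤k _ _ ε _ ε≤1 shrinks G dense = begin
  numIndep G k
    ≤⟨ numIndep≤numIndepIn⊤ G k ⟩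
  numIndepIn G ⊤ k
    ≡⟨ cong (numIndepIn G ⊤) (sym (m+[n∸m]≡n ℓ≤k)) ⟩
  numIndepIn G ⊤ (ℓ + (k ∸ ℓ))
    ≤⟨ numIndepIn-bound G u ε ε≤1 dense (k ∸ ℓ) ⊤ ℓ shrinks-⊤ ⟩
  (∣ ⊤ {n} ∣ C ℓ) * (u C (k ∸ ℓ))
    ≡⟨ cong (λ s → (s C ℓ) * (u C (k ∸ ℓ))) (∣⊤∣≡n n) ⟩
  (n C ℓ) * (u C (k ∸ ℓ)) ∎
  where
  open ≤-Reasoning
  shrinks-⊤ : Shrinks G u ε ε≤1 dense ℓ ⊤
  shrinks-⊤ _ = subst (λ s → (1ℚ - ε) ^ℚ ℓ *ℚ fromℕ s ≤ℚ fromℕ u) (sym (∣⊤∣≡n n)) shrinks
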